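{- Let $(D,\sqcap,\sqcup,\neg,\top,\bot)$ be a Boolean algebra (meet $\sqcap$, join $\sqcup$, complement $\neg$). Setting $\lrcorner a:=\neg a$ for all $a\in D$, the algebra $(D,\sqcup,\sqcap,\neg,\lrcorner,\top,\bot)$ is a double Boolean algebra which is both fully contextual and pure. Conversely, if $\mathbf D=(D,\sqcup,\sqcap,\neg,\lrcorner,\top,\bot)$ is a double Boolean algebra such that $\neg a=\lrcorner a$ and $\neg\neg a=a$ for all $a\in D$, then $(D,\sqcap,\sqcup,\neg,\top,\bot)$ is a Boolean algebra.
   Context: A double Boolean algebra (dBa) is an algebra $\mathbf{D}=(D,\sqcup,\sqcap,\neg,\lrcorner,\top,\bot)$ of type $(2,2,1,1,0,0)$ such that, with $x\vee y:=\neg(\neg x\sqcap\neg y)$ and $x\wedge y:=\lrcorner(\lrcorner x\sqcup\lrcorner y)$, for all $x,y,z\in D$: $(x\sqcap x)\sqcap y=x\sqcap y$; $x\sqcap y=y\sqcap x$; $x\sqcap(y\sqcap z)=(x\sqcap y)\sqcap z$; $\neg(x\sqcap x)=\neg x$; $x\sqcap(x\sqcup y)=x\sqcap x$; $x\sqcap(y\vee z)=(x\sqcap y)\vee(x\sqcap z)$; $x\sqcap(x\vee y)=x\sqcap x$; $\neg\neg(x\sqcap y)=x\sqcap y$; $x\sqcap\neg x=\bot$; $\neg\bot=\top\sqcap\top$; $\neg\top=\bot$; the duals $(x\sqcup x)\sqcup y=x\sqcup y$; $x\sqcup y=y\sqcup x$; $x\sqcup(y\sqcup z)=(x\sqcup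 y)\sqcup z$; $\lrcorner(x\sqcup x)=\lrcorner x$; $x\sqcup(x\sqcap y)=x\sqcup x$; $x\sqcup(y\wedge z)=(x\sqcup y)\wedge(x\sqcup z)$; $x\sqcup(x\wedge y)=x\sqcup x$; $\lrcorner\lrcorner(x\sqcup y)=x\sqcup y$; $x\sqcup\lrcorner x=\top$; $\lrcorner\top=\bot\sqcup\bot$; $\lrcorner\bot=\top$; and $(x\sqcap x)\sqcup(x\sqcap x)=(x\sqcup x)\sqcap(x\sqcup x)$. The quasi-order is $x\sqsubseteq y$ iff $x\sqcap y=x\sqcap x$ and $x\sqcup y=y\sqcup y$. $x_\sqcap:=x\sqcap x$, $x_\sqcup:=x\sqcup x$, $D_\sqcap:=\{x:x_\sqcap=x\}$, $D_\sqcup:=\{x:x_\sqcup=x\}$. $\mathbf D$ is pure if every $x$ satisfies $x_\sqcap=x$ or $x_\sqcup=x$; fully contextual if $\sqsubseteq$ is a partial order and for all $y\in D_\sqcap$, $x\in D_\sqcup$ with $y_\sqcup=x_\sqcap$ there is a unique $z\in D$ with $z_\sqcap=y$ and $z_\sqcup=x$. -}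

module Defs where

open import Level using (Level)
open import Data.Product using (_×_; Σ-syntax; ∃-syntax)
open import Data.Sum using (_⊎_)
open import Relation.Binary.PropositionalEquality using (_≡_)
open import Relation.Binary.Definitions using (Antisymmetric)

record IsDBA {a : Level} {D : Set a}
             (_⊔_ _⊓_ : D → D → D) (¬_ ⌟_ : D → D) (⊤ ⊥ : D) : Set a where
  infixr 6 _∨_ _∧_
  _∨_ : D → D → D
  x ∨ y = ¬ ((¬ x) ⊓ (¬ y))
  _∧_ : D → D → D
  x ∧ y = ⌟ ((⌟ x) ⊔ (⌟ y))
  field
    ⊓-idem-l  : ∀ x y → (x ⊓ x) ⊓ y ≡ x ⊓ y
    ⊓-comm    : ∀ x y → x ⊓ y ≡ y ⊓ x
    ⊓-assoc   : ∀ x y z → x ⊓ (y ⊓ z) ≡ (x ⊓ y) ⊓ z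
    ¬-⊓-idem  : ∀ x → ¬ (x ⊓ x) ≡ ¬ x
    ⊓-absorb-⊔ : ∀ x y → x ⊓ (x ⊔ y) ≡ x ⊓ x
    ⊓-distrib-∨ : ∀ x y z → x ⊓ (y ∨ z) ≡ (x ⊓ y) ∨ (x ⊓ z)
    ⊓-absorb-∨ : ∀ x y → x ⊓ (x ∨ y) ≡ x ⊓ x
    ¬¬-⊓      : ∀ x y → ¬ (¬ (x ⊓ y)) ≡ x ⊓ y
    ⊓-¬       : ∀ x → x ⊓ (¬ x) ≡ ⊥
    ¬⊥        : ¬ ⊥ ≡ ⊤ ⊓ ⊤
    ¬⊤        : ¬ ⊤ ≡ ⊥
    ⊔-idem-l  : ∀ x y → (x ⊔ x) ⊔ y ≡ x ⊔ y
    ⊔-comm    : ∀ x y → x ⊔ y ≡ y ⊔ x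
    ⊔-assoc   : ∀ x y z → x ⊔ (y ⊔ z) ≡ (x ⊔ y) ⊔ z
    ⌟-⊔-idem  : ∀ x → ⌟ (x ⊔ x) ≡ ⌟ x
    ⊔-absorb-⊓ : ∀ x y → x ⊔ (x ⊓ y) ≡ x ⊔ x
    ⊔-distrib-∧ : ∀ x y z → x ⊔ (y ∧ z) ≡ (x ⊔ y) ∧ (x ⊔ z)
    ⊔-absorb-∧ : ∀ x y → x ⊔ (x ∧ y) ≡ x ⊔ x
    ⌟⌟-⊔      : ∀ x y → ⌟ (⌟ (x ⊔ y)) ≡ x ⊔ y
    ⊔-⌟       : ∀ x → x ⊔ (⌟ x) ≡ ⊤
    ⌟⊤        : ⌟ ⊤ ≡ ⊥ ⊔ ⊥
    ⌟⊥        : ⌟ ⊥ ≡ ⊤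
    mixed     : ∀ x → (x ⊓ x) ⊔ (x ⊓ x) ≡ (x ⊔ x) ⊓ (x ⊔ x)

module _ {a : Level} {D : Set a} (_⊔_ _⊓_ : D → D → D) where

  _⊑_ : D → D → Set a
  x ⊑ y = (x ⊓ y ≡ x ⊓ x) × (x ⊔ y ≡ y ⊔ y)

  IsPure : Set a
  IsPure = ∀ x → (x ⊓ x ≡ x) ⊎ (x ⊔ x ≡ x)

  -- ⊑ is a partial order (reflexivity and transitivity hold in every dBa;
  -- the paper's condition "⊑ is a partial order" is stated in full)
  IsFullyContextual : Set a
  IsFullyContextual =
    (∀ x → x ⊑ x) ×
    (∀ x y z → x ⊑ y → y ⊑ z → x ⊑ z) ×
    (∀ x y → x ⊑ y → y ⊑ x → x ≡ y) ×
    (∀ y x → y ⊓ y ≡ y → x ⊔ x ≡ x → y ⊔ y ≡ x ⊓ x →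
       (∃[ z ] ((z ⊓ z ≡ y) × (z ⊔ z ≡ x))) ×
       (∀ z w → z ⊓ z ≡ y → z ⊔ z ≡ x → w ⊓ w ≡ y → w ⊔ w ≡ x → z ≡ w))

-- In a Boolean algebra both operations are idempotent, so every element is its own
-- ⊓- and ⊔-part, the quasi-order ⊑ is the lattice order, and De Morgan's laws turn the
-- derived operations ∨ and ∧ of a dBa back into ⊔ and ⊓. Conversely, if ¬ = ⌟ is
-- involutive then x ⊓ x = ¬¬(x ⊓ x) = ¬¬x = x and dually x ⊔ x = x; the dBa absorption
-- laws then make (D, ⊔, ⊓) a lattice, in which x ∨ y is an upper bound of x and y that
-- lies below x ⊔ y by the dBa distributive law. Hence ∨ = ⊔, and that distributive law
-- becomes ordinary distributivity.
module Submission where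

open import Defs
open import Level using (Level)
open import Data.Product using (_×_; _,_)
open import Data.Sum using (inj₁)
open import Relation.Binary.PropositionalEquality
  using (_≡_; refl; sym; trans; cong; cong₂; isEquivalence; module ≡-Reasoning)
open import Relation.Binary.Bundles using (Poset)
import Relation.Binary.Lattice.Structures as OrderTheoretic
open import Algebra.Lattice.Structures using (IsLattice; IsDistributiveLattice; IsBooleanAlgebra)
open import Algebra.Lattice.Structures.Biased using (isBooleanAlgebraʳ)
open import Algebra.Lattice.Bundles using (Lattice; BooleanAlgebra)
import Algebra.Lattice.Properties.Lattice as LatticeProperties
import Algebra.Lattice.Properties.BooleanAlgebra as BooleanAlgebraProperties
open import Algebra.Consequences.Propositional using (comm∧distrˡ⇒distrʳ; distrib∧absorbs⇒distribˡ)

module LatticeOrder {a : Level} {D : Set a} {_⊔_ _⊓_ : D → D → D}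
                    (isLattice : IsLattice _≡_ _⊔_ _⊓_) where

  private
    lattice : Lattice a a
    lattice = record { isLattice = isLattice }

  open IsLattice isLattice public using (∨-comm; ∨-assoc; ∧-comm; ∨-absorbs-∧; ∧-absorbs-∨)
  open LatticeProperties lattice public
    using (∧-idem; ∨-idem; poset; ∨-∧-isOrderTheoreticLattice)
  open Poset poset public using (_≤_) renaming (trans to ≤-trans; antisym to ≤-antisym)
  open OrderTheoretic.IsLattice ∨-∧-isOrderTheoreticLattice public using (∨-least)

  -- The library order is the left natural order of ⊓: x ≤ y means x ≡ x ⊓ y.
  ⊑⇒≤ : ∀ {x y} → _⊑_ _⊔_ _⊓_ x y → x ≤ y
  ⊑⇒≤ {x} (x⊓y≡x⊓x , _) = sym (trans x⊓y≡x⊓x (∧-idem x))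

  ≤⇒⊑ : ∀ {x y} → x ≤ y → _⊑_ _⊔_ _⊓_ x y
  ≤⇒⊑ {x} {y} x≡x⊓y = trans (sym x≡x⊓y) (sym (∧-idem x)) , x⊔y≡y⊔y
    where
    open ≡-Reasoning
    x⊔y≡y⊔y : x ⊔ y ≡ y ⊔ y
    x⊔y≡y⊔y = begin
      x ⊔ y        ≡⟨ cong (_⊔ y) x≡x⊓y ⟩
      (x ⊓ y) ⊔ y  ≡⟨ ∨-comm (x ⊓ y) y ⟩
      y ⊔ (x ⊓ y)  ≡⟨ cong (y ⊔_) (∧-comm x y) ⟩
      y ⊔ (y ⊓ x)  ≡⟨ ∨-absorbs-∧ y x ⟩
      y            ≡⟨ ∨-idem y ⟨
      y ⊔ y        ∎

module _ {a : Level} {D : Set a} {_⊔_ _⊓_ : D → D → D}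
         (isLattice : IsLattice _≡_ _⊔_ _⊓_) where

  open LatticeOrder isLattice

  isLattice⇒isPure : IsPure _⊔_ _⊓_
  isLattice⇒isPure x = inj₁ (∧-idem x)

  isLattice⇒isFullyContextual : IsFullyContextual _⊔_ _⊓_
  isLattice⇒isFullyContextual =
      (λ x → refl , refl)
    , (λ x y z x⊑y y⊑z → ≤⇒⊑ (≤-trans (⊑⇒≤ x⊑y) (⊑⇒≤ y⊑z)))
    , (λ x y x⊑y y⊑x → ≤-antisym (⊑⇒≤ x⊑y) (⊑⇒≤ y⊑x))
    , λ y x _ _ y⊔y≡x⊓x →
        (y , ∧-idem y , trans y⊔y≡x⊓x (∧-idem x))
      , λ z w z⊓z≡y _ w⊓w≡y _ →
          trans (sym (∧-idem z)) (trans z⊓z≡y (trans (sym w⊓w≡y) (∧-idem w)))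

module BooleanAlgebraMeetLaws {a : Level} {D : Set a} {_⊔_ _⊓_ : D → D → D} {¬_ : D → D} {⊤ ⊥ : D}
                              (isBooleanAlgebra : IsBooleanAlgebra _≡_ _⊔_ _⊓_ ¬_ ⊤ ⊥) where

  open IsBooleanAlgebra isBooleanAlgebra
    using (∧-comm; ∧-assoc; ∧-absorbs-∨; ∧-distribˡ-∨; ∧-complementʳ)

  private
    booleanAlgebra : BooleanAlgebra a a
    booleanAlgebra = record { isBooleanAlgebra = isBooleanAlgebra }

  open BooleanAlgebraProperties booleanAlgebra
    using (∧-idem; ¬-involutive; deMorgan₁; ¬⊥≈⊤; ¬⊤≈⊥)
  open ≡-Reasoning

  ¬-⊓-¬ : ∀ x y → ¬ ((¬ x) ⊓ (¬ y)) ≡ x ⊔ y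
  ¬-⊓-¬ x y = trans (deMorgan₁ (¬ x) (¬ y)) (cong₂ _⊔_ (¬-involutive x) (¬-involutive y))

  ⊓-idem-l : ∀ x y → (x ⊓ x) ⊓ y ≡ x ⊓ y
  ⊓-idem-l x y = cong (_⊓ y) (∧-idem x)

  ⊓-comm : ∀ x y → x ⊓ y ≡ y ⊓ x
  ⊓-comm = ∧-comm

  ⊓-assoc : ∀ x y z → x ⊓ (y ⊓ z) ≡ (x ⊓ y) ⊓ z
  ⊓-assoc x y z = sym (∧-assoc x y z)

  ¬-⊓-idem : ∀ x → ¬ (x ⊓ x) ≡ ¬ x
  ¬-⊓-idem x = cong ¬_ (∧-idem x)

  ⊓-absorb-⊔ : ∀ x y → x ⊓ (x ⊔ y) ≡ x ⊓ x
  ⊓-absorb-⊔ x y = trans (∧-absorbs-∨ x y) (sym (∧-idem x))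

  ⊓-distrib-∨ : ∀ x y z → x ⊓ (¬ ((¬ y) ⊓ (¬ z))) ≡ ¬ ((¬ (x ⊓ y)) ⊓ (¬ (x ⊓ z)))
  ⊓-distrib-∨ x y z = begin
    x ⊓ (¬ ((¬ y) ⊓ (¬ z)))           ≡⟨ cong (x ⊓_) (¬-⊓-¬ y z) ⟩
    x ⊓ (y ⊔ z)                       ≡⟨ ∧-distribˡ-∨ x y z ⟩
    (x ⊓ y) ⊔ (x ⊓ z)                 ≡⟨ ¬-⊓-¬ (x ⊓ y) (x ⊓ z) ⟨
    ¬ ((¬ (x ⊓ y)) ⊓ (¬ (x ⊓ z)))     ∎

  ⊓-absorb-∨ : ∀ x y → x ⊓ (¬ ((¬ x) ⊓ (¬ y))) ≡ x ⊓ x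
  ⊓-absorb-∨ x y = trans (cong (x ⊓_) (¬-⊓-¬ x y)) (⊓-absorb-⊔ x y)

  ¬¬-⊓ : ∀ x y → ¬ (¬ (x ⊓ y)) ≡ x ⊓ y
  ¬¬-⊓ x y = ¬-involutive (x ⊓ y)

  ⊓-¬ : ∀ x → x ⊓ (¬ x) ≡ ⊥
  ⊓-¬ = ∧-complementʳ

  ¬⊥ : ¬ ⊥ ≡ ⊤ ⊓ ⊤
  ¬⊥ = trans ¬⊥≈⊤ (sym (∧-idem ⊤))

  ¬⊤ : ¬ ⊤ ≡ ⊥
  ¬⊤ = ¬⊤≈⊥

module _ {a : Level} {D : Set a} {_⊔_ _⊓_ : D → D → D} {¬_ : D → D} {⊤ ⊥ : D} where

  isBooleanAlgebra⇒isDBA : IsBooleanAlgebra _≡_ _⊔_ _⊓_ ¬_ ⊤ ⊥ → IsDBA _⊔_ _⊓_ ¬_ ¬_ ⊤ ⊥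
  isBooleanAlgebra⇒isDBA isBooleanAlgebra = record
    { Meet
    ; Join renaming
        ( ⊓-idem-l to ⊔-idem-l; ⊓-comm to ⊔-comm; ⊓-assoc to ⊔-assoc; ¬-⊓-idem to ⌟-⊔-idem
        ; ⊓-absorb-⊔ to ⊔-absorb-⊓; ⊓-distrib-∨ to ⊔-distrib-∧; ⊓-absorb-∨ to ⊔-absorb-∧
        ; ¬¬-⊓ to ⌟⌟-⊔; ⊓-¬ to ⊔-⌟; ¬⊥ to ⌟⊤; ¬⊤ to ⌟⊥ )
    ; mixed = λ x → trans ([x⊓x]⊔[x⊓x]≡x x) (sym ([x⊔x]⊓[x⊔x]≡x x))
    }
    where
    booleanAlgebra : BooleanAlgebra a a
    booleanAlgebra = record { isBooleanAlgebra = isBooleanAlgebra }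

    open BooleanAlgebraProperties booleanAlgebra using (∧-idem; ∨-idem; ∧-∨-isBooleanAlgebra)

    module Meet = BooleanAlgebraMeetLaws isBooleanAlgebra
      hiding (¬-⊓-¬)
    -- The join laws are the meet laws of the dual Boolean algebra.
    module Join = BooleanAlgebraMeetLaws ∧-∨-isBooleanAlgebra
      hiding (¬-⊓-¬)

    [x⊓x]⊔[x⊓x]≡x : ∀ x → (x ⊓ x) ⊔ (x ⊓ x) ≡ x
    [x⊓x]⊔[x⊓x]≡x x = trans (cong₂ _⊔_ (∧-idem x) (∧-idem x)) (∨-idem x)

    [x⊔x]⊓[x⊔x]≡x : ∀ x → (x ⊔ x) ⊓ (x ⊔ x) ≡ x
    [x⊔x]⊓[x⊔x]≡x x = trans (cong₂ _⊓_ (∨-idem x) (∨-idem x)) (∧-idem x)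

module _ {a : Level} {D : Set a} {_⊔_ _⊓_ : D → D → D} {¬_ ⌟_ : D → D} {⊤ ⊥ : D}
         (isDBA : IsDBA _⊔_ _⊓_ ¬_ ⌟_ ⊤ ⊥) where

  open IsDBA isDBA
  open ≡-Reasoning

  ¬-involutive⇒⊓-idem : (∀ x → ¬ (¬ x) ≡ x) → ∀ x → x ⊓ x ≡ x
  ¬-involutive⇒⊓-idem ¬-involutive x = begin
    x ⊓ x            ≡⟨ ¬-involutive (x ⊓ x) ⟨
    ¬ (¬ (x ⊓ x))    ≡⟨ cong ¬_ (¬-⊓-idem x) ⟩
    ¬ (¬ x)          ≡⟨ ¬-involutive x ⟩
    x                ∎

  ⌟-involutive⇒⊔-idem : (∀ x → ⌟ (⌟ x) ≡ x) → ∀ x → x ⊔ x ≡ x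
  ⌟-involutive⇒⊔-idem ⌟-involutive x = begin
    x ⊔ x            ≡⟨ ⌟⌟-⊔ x x ⟨
    ⌟ (⌟ (x ⊔ x))    ≡⟨ cong ⌟_ (⌟-⊔-idem x) ⟩
    ⌟ (⌟ x)          ≡⟨ ⌟-involutive x ⟩
    x                ∎

  module _ (⊓-idem : ∀ x → x ⊓ x ≡ x) (⊔-idem : ∀ x → x ⊔ x ≡ x) where

    idempotent⇒isLattice : IsLattice _≡_ _⊔_ _⊓_
    idempotent⇒isLattice = record
      { isEquivalence = isEquivalence
      ; ∨-comm        = ⊔-comm
      ; ∨-assoc       = λ x y z → sym (⊔-assoc x y z)
      ; ∨-cong        = cong₂ _⊔_
      ; ∧-comm        = ⊓-comm
      ; ∧-assoc       = λ x y z → sym (⊓-assoc x y z)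
      ; ∧-cong        = cong₂ _⊓_
      ; absorptive    = (λ x y → trans (⊔-absorb-⊓ x y) (⊔-idem x))
                      , (λ x y → trans (⊓-absorb-⊔ x y) (⊓-idem x))
      }

    open LatticeOrder idempotent⇒isLattice using (_≤_; ∨-least; ∨-assoc; ∧-absorbs-∨; ∨-absorbs-∧)

    ∨≡⊔ : ∀ x y → x ∨ y ≡ x ⊔ y
    ∨≡⊔ x y = begin
      x ∨ y                          ≡⟨ cong₂ _∨_ (∧-absorbs-∨ x y) y⊓[x⊔y]≡y ⟨
      (x ⊓ (x ⊔ y)) ∨ (y ⊓ (x ⊔ y))  ≡⟨ cong₂ _∨_ (⊓-comm x (x ⊔ y)) (⊓-comm y (x ⊔ y)) ⟩
      ((x ⊔ y) ⊓ x) ∨ ((x ⊔ y) ⊓ y)  ≡⟨ ⊓-distrib-∨ (x ⊔ y) x y ⟨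
      (x ⊔ y) ⊓ (x ∨ y)              ≡⟨ ∨-least x≤x∨y y≤x∨y ⟨
      x ⊔ y                          ∎
      where
      y⊓[x⊔y]≡y : y ⊓ (x ⊔ y) ≡ y
      y⊓[x⊔y]≡y = trans (cong (y ⊓_) (⊔-comm x y)) (∧-absorbs-∨ y x)
      x≤x∨y : x ≤ x ∨ y
      x≤x∨y = sym (trans (⊓-absorb-∨ x y) (⊓-idem x))
      y≤x∨y : y ≤ x ∨ y
      y≤x∨y = sym (trans (cong (y ⊓_) (cong ¬_ (⊓-comm (¬ x) (¬ y))))
                         (trans (⊓-absorb-∨ y x) (⊓-idem y)))

    ⊓-distribˡ-⊔ : ∀ x y z → x ⊓ (y ⊔ z) ≡ (x ⊓ y) ⊔ (x ⊓ z)
    ⊓-distribˡ-⊔ x y z = begin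
      x ⊓ (y ⊔ z)        ≡⟨ cong (x ⊓_) (∨≡⊔ y z) ⟨
      x ⊓ (y ∨ z)        ≡⟨ ⊓-distrib-∨ x y z ⟩
      (x ⊓ y) ∨ (x ⊓ z)  ≡⟨ ∨≡⊔ (x ⊓ y) (x ⊓ z) ⟩
      (x ⊓ y) ⊔ (x ⊓ z)  ∎

    idempotent⇒isDistributiveLattice : IsDistributiveLattice _≡_ _⊔_ _⊓_
    idempotent⇒isDistributiveLattice = record
      { isLattice   = idempotent⇒isLattice
      ; ∨-distrib-∧ = ⊔-distribˡ-⊓ , comm∧distrˡ⇒distrʳ ⊔-comm ⊔-distribˡ-⊓
      ; ∧-distrib-∨ = ⊓-distrib-⊔
      }
      where
      ⊓-distrib-⊔ : (∀ x y z → x ⊓ (y ⊔ z) ≡ (x ⊓ y) ⊔ (x ⊓ z))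
                  × (∀ x y z → (y ⊔ z) ⊓ x ≡ (y ⊓ x) ⊔ (z ⊓ x))
      ⊓-distrib-⊔ = ⊓-distribˡ-⊔ , comm∧distrˡ⇒distrʳ ⊓-comm ⊓-distribˡ-⊔
      ⊔-distribˡ-⊓ : ∀ x y z → x ⊔ (y ⊓ z) ≡ (x ⊔ y) ⊓ (x ⊔ z)
      ⊔-distribˡ-⊓ = distrib∧absorbs⇒distribˡ (cong₂ _⊔_) ∨-assoc ⊓-comm ∨-absorbs-∧ ∧-absorbs-∨ ⊓-distrib-⊔

  ¬≗⌟⇒isBooleanAlgebra : (∀ x → ¬ x ≡ ⌟ x) → (∀ x → ¬ (¬ x) ≡ x) → IsBooleanAlgebra _≡_ _⊔_ _⊓_ ¬_ ⊤ ⊥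
  ¬≗⌟⇒isBooleanAlgebra ¬≗⌟ ¬-involutive = isBooleanAlgebraʳ record
    { isDistributiveLattice = idempotent⇒isDistributiveLattice
                                (¬-involutive⇒⊓-idem ¬-involutive) (⌟-involutive⇒⊔-idem ⌟-involutive)
    ; ∨-complementʳ         = λ x → trans (cong (x ⊔_) (¬≗⌟ x)) (⊔-⌟ x)
    ; ∧-complementʳ         = ⊓-¬
    ; ¬-cong                = cong ¬_
    }
    where
    ⌟-involutive : ∀ x → ⌟ (⌟ x) ≡ x
    ⌟-involutive x = trans (sym (¬≗⌟ (⌟ x))) (trans (cong ¬_ (sym (¬≗⌟ x))) (¬-involutive x))

mainTheorem12 : ∀ {a : Level} {D : Set a} (_⊔_ _⊓_ : D → D → D) (¬_ : D → D) (⊤ ⊥ : D) →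
    (IsBooleanAlgebra _≡_ _⊔_ _⊓_ ¬_ ⊤ ⊥ →
      IsDBA _⊔_ _⊓_ ¬_ ¬_ ⊤ ⊥ × IsFullyContextual _⊔_ _⊓_ × IsPure _⊔_ _⊓_)
    × (∀ (⌟_ : D → D) → IsDBA _⊔_ _⊓_ ¬_ ⌟_ ⊤ ⊥ → (∀ x → ¬_ x ≡ ⌟_ x) → (∀ x → ¬_ (¬_ x) ≡ x) →
      IsBooleanAlgebra _≡_ _⊔_ _⊓_ ¬_ ⊤ ⊥)
mainTheorem12 _⊔_ _⊓_ ¬_ ⊤ ⊥ =
    (λ isBooleanAlgebra →
        isBooleanAlgebra⇒isDBA isBooleanAlgebra
      , isLattice⇒isFullyContextual (IsBooleanAlgebra.isLattice isBooleanAlgebra)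
      , isLattice⇒isPure (IsBooleanAlgebra.isLattice isBooleanAlgebra))
  , λ ⌟_ isDBA ¬≗⌟ ¬-involutive → ¬≗⌟⇒isBooleanAlgebra isDBA ¬≗⌟ ¬-involutive
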